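{- Let $D=(A,B,\lambda)$ be a temporal bi-clique with $|A|=|B|$. Then there is a temporal clique $C=(A\sqcup B,\lambda')$ such that for every spanner $S$ of $C$, the set $S\cap\{\{a,b\}: a\in A, b\in B\}$ is a bi-spanner of $D$.
   Context: A temporal graph is $(V,E,\lambda)$ with $\lambda\colon E\to\mathbb{N}$. A path $v_1\dots v_k$ is temporal if $\lambda(\{v_i,v_{i+1}\})\le\lambda(\{v_{i+1},v_{i+2}\})$ for all $i\in[k-2]$. A temporal clique $(V,\lambda)$ has the complete graph on $V$ as underlying graph; a spanner is an edge set $S$ such that every vertex reaches every other vertex by a temporal path within $S$. A temporal bi-clique $(A,B,\lambda)$ has the complete bipartite graph with disjoint parts $A,B$ as underlying graph; a bi-spanner is an edge set $S$ such that every $a\in A$ reaches every $b\in B$ by a temporal path within $S$. -}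

module Defs where

open import Data.Nat using (ℕ; _≤_)
open import Data.Fin using (Fin)
open import Data.Sum using (_⊎_; inj₁; inj₂)
open import Data.Product using (_×_; Σ)
open import Data.Unit using (⊤)
open import Data.Empty using (⊥)
open import Data.List using (List; []; _∷_; _∷ʳ_)
open import Data.List.Relation.Unary.Unique.Propositional using (Unique)
open import Relation.Binary.PropositionalEquality using (_≡_)
open import Relation.Nullary using (¬_)

-- An edge set is given by a relation E; labels by a function on ordered
-- pairs (only used on pairs that are edges; symmetric where required).

EdgesIn : {V : Set} → (V → V → Set) → List V → Set
EdgesIn E (x ∷ y ∷ r) = E x y × EdgesIn E (y ∷ r)
EdgesIn E _ = ⊤

TemporalLabels : {V : Set} → (V → V → ℕ) → List V → Set
TemporalLabels lab (x ∷ y ∷ z ∷ r) = lab x y ≤ lab y z × TemporalLabels lab (y ∷ z ∷ r)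
TemporalLabels lab _ = ⊤

IsTemporalPath : {V : Set} → (V → V → Set) → (V → V → ℕ) → List V → Set
IsTemporalPath E lab vs = Unique vs × EdgesIn E vs × TemporalLabels lab vs

Reaches : {V : Set} → (V → V → Set) → (V → V → ℕ) → V → V → Set
Reaches E lab u v = Σ (List _) (λ mid → IsTemporalPath E lab (u ∷ mid ∷ʳ v))

Vert : ℕ → Set
Vert n = Fin n ⊎ Fin n

-- Temporal clique on A ⊔ B: labelling of unordered pairs, represented as a
-- symmetric function on ordered pairs.
SymLabel : (n : ℕ) → (Vert n → Vert n → ℕ) → Set
SymLabel n lab = ∀ u v → lab u v ≡ lab v u

-- S : Vert n → Vert n → Set represents the edge set {{u,v} | S u v or S v u}.
-- S is a spanner of the clique (A ⊔ B, lab).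
IsSpanner : (n : ℕ) → (Vert n → Vert n → ℕ) → (Vert n → Vert n → Set) → Set
IsSpanner n lab S = ∀ (u v : Vert n) → ¬ (u ≡ v) → Reaches (λ x y → S x y ⊎ S y x) lab u v

-- Temporal bi-clique (A, B, λ) with λ : A × B → ℕ and edge subsets given by
-- T : A → B → Set. The bipartite graph on A ⊔ B:
biEdge : (n : ℕ) → (Fin n → Fin n → Set) → Vert n → Vert n → Set
biEdge n T (inj₁ a) (inj₂ b) = T a b
biEdge n T (inj₂ b) (inj₁ a) = T a b
biEdge n T _ _ = ⊥

biLabel : (n : ℕ) → (Fin n → Fin n → ℕ) → Vert n → Vert n → ℕ
biLabel n lab (inj₁ a) (inj₂ b) = lab a b
biLabel n lab (inj₂ b) (inj₁ a) = lab a b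
biLabel n lab _ _ = 0

IsBiSpanner : (n : ℕ) → (Fin n → Fin n → ℕ) → (Fin n → Fin n → Set) → Set
IsBiSpanner n lab T = ∀ (a b : Fin n) → Reaches (biEdge n T) (biLabel n lab) (inj₁ a) (inj₂ b)

bipartPart : (n : ℕ) → (Vert n → Vert n → Set) → Fin n → Fin n → Set
bipartPart n S a b = S (inj₁ a) (inj₂ b) ⊎ S (inj₂ b) (inj₁ a)

-- Label the clique on A ⊔ B as follows: cross edges {a, b} get λ(a, b) + 1,
-- edges inside B get 0, and edges inside A get a label M + 2 exceeding every
-- cross label. A temporal path from A to B can then contain no edge inside B
-- (it would follow a positive label), and no edge inside A (after it only
-- edges inside A are late enough, so B is never reached). So it alternates
-- between A and B, and shifting its labels down by one turns it into a
-- temporal path of the bi-clique.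
module Submission where

open import Defs
open import Data.Nat using (ℕ; zero; suc; _+_; _≤_; z≤n; s≤s; s≤s⁻¹)
open import Data.Nat.Properties using (≤-trans; ≤-refl; m≤m+n; m≤n+m; <⇒≱)
open import Data.Fin using (Fin; zero; suc)
open import Data.Product using (Σ; _×_; _,_)
open import Data.Sum using (_⊎_; inj₁; inj₂; swap)
open import Data.Unit using (⊤; tt)
open import Data.Empty using (⊥; ⊥-elim)
open import Data.List using (List; []; _∷_; _∷ʳ_)
open import Relation.Binary.PropositionalEquality using (_≡_; refl; subst₂)

sumFin : (n : ℕ) → (Fin n → ℕ) → ℕ
sumFin zero    f = 0
sumFin (suc n) f = f zero + sumFin n (λ i → f (suc i))

≤-sumFin : (n : ℕ) (f : Fin n → ℕ) (i : Fin n) → f i ≤ sumFin n f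
≤-sumFin (suc n) f zero    = m≤m+n (f zero) _
≤-sumFin (suc n) f (suc i) = ≤-trans (≤-sumFin n (λ j → f (suc j)) i) (m≤n+m _ (f zero))

module _ {V : Set} where

  TemporalFrom : (V → V → ℕ) → ℕ → List V → Set
  TemporalFrom lab p (x ∷ y ∷ r) = p ≤ lab x y × TemporalFrom lab (lab x y) (y ∷ r)
  TemporalFrom lab p _           = ⊤

  temporalLabels⇒temporalFrom : (lab : V → V → ℕ) (ws : List V) →
    TemporalLabels lab ws → TemporalFrom lab 0 ws
  temporalLabels⇒temporalFrom lab []          _ = tt
  temporalLabels⇒temporalFrom lab (x ∷ [])    _ = tt
  temporalLabels⇒temporalFrom lab (x ∷ y ∷ r) t = z≤n , from x y r t
    where
    from : ∀ x y r → TemporalLabels lab (x ∷ y ∷ r) → TemporalFrom lab (lab x y) (y ∷ r)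
    from x y []      _        = tt
    from x y (z ∷ r) (le , t) = le , from y z r t

  edgesIn-zipWith : {P E F : V → V → Set} → (∀ {x y} → P x y → E x y → F x y) →
    (ws : List V) → EdgesIn P ws → EdgesIn E ws → EdgesIn F ws
  edgesIn-zipWith f []          _        _        = tt
  edgesIn-zipWith f (x ∷ [])    _        _        = tt
  edgesIn-zipWith f (x ∷ y ∷ r) (p , ps) (e , es) = f p e , edgesIn-zipWith f (y ∷ r) ps es

  temporalLabels-pred : {P : V → V → Set} {lab lab′ : V → V → ℕ} →
    (∀ {x y} → P x y → lab x y ≡ suc (lab′ x y)) →
    (ws : List V) → EdgesIn P ws → TemporalLabels lab ws → TemporalLabels lab′ ws
  temporalLabels-pred eq []              _              _        = tt
  temporalLabels-pred eq (x ∷ [])        _              _        = tt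
  temporalLabels-pred eq (x ∷ y ∷ [])    _              _        = tt
  temporalLabels-pred eq (x ∷ y ∷ z ∷ r) (p , q , ps) (le , t) =
    s≤s⁻¹ (subst₂ _≤_ (eq p) (eq q) le) , temporalLabels-pred eq (y ∷ z ∷ r) (q , ps) t

module Construction (n : ℕ) (lab : Fin n → Fin n → ℕ) where

  M : ℕ
  M = sumFin n (λ a → sumFin n (lab a))

  lab≤M : ∀ a b → lab a b ≤ M
  lab≤M a b = ≤-trans (≤-sumFin n (lab a) b) (≤-sumFin n (λ a → sumFin n (lab a)) a)

  cliqueLabel : Vert n → Vert n → ℕ
  cliqueLabel (inj₁ _) (inj₁ _) = suc (suc M)
  cliqueLabel (inj₁ a) (inj₂ b) = suc (lab a b)
  cliqueLabel (inj₂ b) (inj₁ a) = suc (lab a b)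
  cliqueLabel (inj₂ _) (inj₂ _) = 0

  cliqueLabel-sym : SymLabel n cliqueLabel
  cliqueLabel-sym (inj₁ _) (inj₁ _) = refl
  cliqueLabel-sym (inj₁ _) (inj₂ _) = refl
  cliqueLabel-sym (inj₂ _) (inj₁ _) = refl
  cliqueLabel-sym (inj₂ _) (inj₂ _) = refl

  Cross : Vert n → Vert n → Set
  Cross (inj₁ _) (inj₂ _) = ⊤
  Cross (inj₂ _) (inj₁ _) = ⊤
  Cross _        _        = ⊥

  cliqueLabel-cross : ∀ {x y} → Cross x y → cliqueLabel x y ≡ suc (biLabel n lab x y)
  cliqueLabel-cross {inj₁ _} {inj₂ _} _ = refl
  cliqueLabel-cross {inj₂ _} {inj₁ _} _ = refl

  cross-late : ∀ {q} a b → suc (suc M) ≤ q → q ≤ suc (lab a b) → ⊥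
  cross-late a b M+2≤q q≤lab = <⇒≱ (s≤s (s≤s (lab≤M a b))) (≤-trans M+2≤q q≤lab)

  temporalFrom-late-¬B : ∀ q a mid b → suc (suc M) ≤ q →
    TemporalFrom cliqueLabel q (inj₁ a ∷ (mid ∷ʳ inj₂ b)) → ⊥
  temporalFrom-late-¬B q a []              b late (le , _) = cross-late a b late le
  temporalFrom-late-¬B q a (inj₁ a′ ∷ mid) b late (_ , t)  = temporalFrom-late-¬B _ a′ mid b ≤-refl t
  temporalFrom-late-¬B q a (inj₂ b′ ∷ mid) b late (le , _) = cross-late a b′ late le

  mutual
    temporalFromA-cross : ∀ p a mid b → TemporalFrom cliqueLabel p (inj₁ a ∷ (mid ∷ʳ inj₂ b)) →
      EdgesIn Cross (inj₁ a ∷ (mid ∷ʳ inj₂ b))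
    temporalFromA-cross p a []              b _       = tt , tt
    temporalFromA-cross p a (inj₁ a′ ∷ mid) b (_ , t) = ⊥-elim (temporalFrom-late-¬B _ a′ mid b ≤-refl t)
    temporalFromA-cross p a (inj₂ b′ ∷ mid) b (_ , t) = tt , temporalFromB-cross (lab a b′) b′ mid b t

    temporalFromB-cross : ∀ k b′ mid b → TemporalFrom cliqueLabel (suc k) (inj₂ b′ ∷ (mid ∷ʳ inj₂ b)) →
      EdgesIn Cross (inj₂ b′ ∷ (mid ∷ʳ inj₂ b))
    temporalFromB-cross k b′ []              b (() , _)
    temporalFromB-cross k b′ (inj₁ a ∷ mid)  b (_ , t) = tt , temporalFromA-cross _ a mid b t
    temporalFromB-cross k b′ (inj₂ b″ ∷ mid) b (() , _)

  cross⇒biEdge : (S : Vert n → Vert n → Set) →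
    ∀ {x y} → Cross x y → S x y ⊎ S y x → biEdge n (bipartPart n S) x y
  cross⇒biEdge S {inj₁ _} {inj₂ _} _ e = e
  cross⇒biEdge S {inj₂ _} {inj₁ _} _ e = swap e

  spanner⇒biSpanner : (S : Vert n → Vert n → Set) →
    IsSpanner n cliqueLabel S → IsBiSpanner n lab (bipartPart n S)
  spanner⇒biSpanner S span a b with span (inj₁ a) (inj₂ b) (λ ())
  ... | mid , unique , edges , temporal =
    mid , unique , edgesIn-zipWith (cross⇒biEdge S) path cross edges ,
    temporalLabels-pred cliqueLabel-cross path cross temporal
    where
    path : List (Vert n)
    path = inj₁ a ∷ (mid ∷ʳ inj₂ b)
    cross : EdgesIn Cross path
    cross = temporalFromA-cross 0 a mid b (temporalLabels⇒temporalFrom cliqueLabel path temporal)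

lemma7 : (n : ℕ) (lab : Fin n → Fin n → ℕ) →
    Σ (Vert n → Vert n → ℕ) (λ lab′ → SymLabel n lab′ ×
    ((S : Vert n → Vert n → Set) → IsSpanner n lab′ S → IsBiSpanner n lab (bipartPart n S)))
lemma7 n lab = cliqueLabel , cliqueLabel-sym , spanner⇒biSpanner
  where open Construction n lab
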